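{- Suppose the following statement (*) holds: for every $m\ge1$, every nondecreasing antipodal function $f:\{0,1\}^m\to\mathbb{R}$ and every decreasing family $\mathcal{I}\subseteq\{0,1\}^m$, $$\sum_{A\in\mathcal{I}}\tilde f(A)\ge\sum_{A\in\mathcal{I}}f^*(A),$$ where $f^*(x)=\max(f(x),0)^2$, $\lambda_i=\sum\{\hat f(S)^2: S\neq\emptyset,\ \max(S)=i\}$ for $1\le i\le m$, and $\tilde f=\sum_{i=1}^m\lambda_i\chi_i$ with $\chi_i$ the indicator function of $\{A\subseteq[m]: i\in A\}$. Then for every $n\ge1$ and all increasing $\mathcal{A},\mathcal{B}\subseteq\{0,1\}^n$, $$\mathrm{Cor}(\mathcal{A},\mathcal{B})\ge\frac12\sum_{i=1}^n I_i(\mathcal{A})\sum\{\hat{\mathcal{B}}(S)^2: S\neq\emptyset,\ \max(S)=i\}.$$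
   Context: Subsets of $[m]$ are identified with elements of $\{0,1\}^m$; $\mu$ is the uniform probability measure. A family is increasing (decreasing) if closed under supersets (subsets). A function $f$ is nondecreasing if $A\subseteq B$ implies $f(A)\le f(B)$, and antipodal if $f(A^c)=-f(A)$ for all $A$. Fourier–Walsh coefficients: $\hat f(S)=\mathbb{E}_\mu[f\,u_S]$ where $u_S(T)=(-1)^{|S\cap T|}$; for a family $\mathcal{C}$, $\hat{\mathcal{C}}(S)$ denotes the Fourier coefficient of its indicator function. $\mathrm{Cor}(\mathcal{A},\mathcal{B})=\mu(\mathcal{A}\cap\mathcal{B})-\mu(\mathcal{A})\mu(\mathcal{B})$. $I_i(\mathcal{A})=2\mu(\{x\in\mathcal{A}: x\oplus e_i\notin\mathcal{A}\})$, where $x\oplus e_i$ flips the $i$-th coordinate of $x$. -}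

module Defs where

open import Data.Bool using (Bool; true; false; not; _∧_; if_then_else_)
open import Data.Nat as ℕ using (ℕ; zero; suc)
open import Data.Fin using (Fin; zero; suc)
open import Data.Vec using (Vec; []; _∷_; lookup; map; _[_]%=_)
open import Data.List as L using (List; _++_; [_])
open import Data.Rational using (ℚ; 0ℚ; 1ℚ; ½; _+_; _*_; -_; _-_; _⊔_; _≤_)
open import Relation.Binary.PropositionalEquality using (_≡_)

-- The cube {0,1}^m : subsets of [m] as Boolean vectors (coordinate i ∈ Fin m).
Cube : ℕ → Set
Cube m = Vec Bool m

Family : ℕ → Set
Family m = Cube m → Bool

allCube : (m : ℕ) → List (Cube m)
allCube zero    = [ [] ]
allCube (suc m) = L.map (true ∷_) (allCube m) ++ L.map (false ∷_) (allCube m)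

sumℚ : List ℚ → ℚ
sumℚ = L.foldr _+_ 0ℚ

Σcube : (m : ℕ) → (Cube m → ℚ) → ℚ
Σcube m g = sumℚ (L.map g (allCube m))

ΣFin : (m : ℕ) → (Fin m → ℚ) → ℚ
ΣFin m g = sumℚ (L.map g (L.allFin m))

powℚ : ℚ → ℕ → ℚ
powℚ q zero    = 1ℚ
powℚ q (suc k) = q * powℚ q k

sq : ℚ → ℚ
sq q = q * q

𝔼 : (m : ℕ) → (Cube m → ℚ) → ℚ
𝔼 m g = powℚ ½ m * Σcube m g

ind : Bool → ℚ
ind b = if b then 1ℚ else 0ℚ

𝟙 : {m : ℕ} → Family m → Cube m → ℚ
𝟙 𝒜 x = ind (𝒜 x)

μ : (m : ℕ) → Family m → ℚ
μ m 𝒜 = 𝔼 m (𝟙 𝒜)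

u : {m : ℕ} → Cube m → Cube m → ℚ
u []      []      = 1ℚ
u (s ∷ S) (t ∷ T) = (if s ∧ t then - 1ℚ else 1ℚ) * u S T

fhat : (m : ℕ) → (Cube m → ℚ) → Cube m → ℚ
fhat m f S = 𝔼 m (λ T → f T * u S T)

allFalse : {m : ℕ} → Cube m → Bool
allFalse []      = true
allFalse (b ∷ S) = not b ∧ allFalse S

-- isMax S i = true iff S ≠ ∅ and max(S) = i  (i ∈ S and no j > i lies in S)
isMax : {m : ℕ} → Cube m → Fin m → Bool
isMax (b ∷ S) zero    = b ∧ allFalse S
isMax (b ∷ S) (suc i) = isMax S i

lam : (m : ℕ) → (Cube m → ℚ) → Fin m → ℚ
lam m f i = Σcube m (λ S → if isMax S i then sq (fhat m f S) else 0ℚ)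

ftilde : (m : ℕ) → (Cube m → ℚ) → Cube m → ℚ
ftilde m f A = ΣFin m (λ i → if lookup A i then lam m f i else 0ℚ)

fstar : {m : ℕ} → (Cube m → ℚ) → Cube m → ℚ
fstar f x = sq (f x ⊔ 0ℚ)

Σfam : (m : ℕ) → Family m → (Cube m → ℚ) → ℚ
Σfam m 𝓘 g = Σcube m (λ A → if 𝓘 A then g A else 0ℚ)

_⊆_ : {m : ℕ} → Cube m → Cube m → Set
_⊆_ {m} x y = (i : Fin m) → lookup x i ≡ true → lookup y i ≡ true

Increasing : {m : ℕ} → Family m → Set
Increasing 𝒜 = ∀ x y → x ⊆ y → 𝒜 x ≡ true → 𝒜 y ≡ true

Decreasing : {m : ℕ} → Family m → Set
Decreasing 𝒜 = ∀ x y → x ⊆ y → 𝒜 y ≡ true → 𝒜 x ≡ true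

Nondecreasing : {m : ℕ} → (Cube m → ℚ) → Set
Nondecreasing f = ∀ x y → x ⊆ y → f x ≤ f y

Antipodal : {m : ℕ} → (Cube m → ℚ) → Set
Antipodal f = ∀ x → f (map not x) ≡ - f x

_∩_ : {m : ℕ} → Family m → Family m → Family m
(𝒜 ∩ ℬ) x = 𝒜 x ∧ ℬ x

Cor : (m : ℕ) → Family m → Family m → ℚ
Cor m 𝒜 ℬ = μ m (𝒜 ∩ ℬ) - μ m 𝒜 * μ m ℬ

Infl : (m : ℕ) → Family m → Fin m → ℚ
Infl m 𝒜 i = (1ℚ + 1ℚ) * μ m (λ x → 𝒜 x ∧ not (𝒜 (x [ i ]%= not)))

Star : Set
Star = (m : ℕ) → 1 ℕ.≤ m → (f : Cube m → ℚ) → Nondecreasing f → Antipodal f →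
       (𝓘 : Family m) → Decreasing 𝓘 →
       Σfam m 𝓘 (fstar f) ≤ Σfam m 𝓘 (ftilde m f)

module Submission where

-- Add a new front coordinate t and apply (*) on {0,1}ⁿ⁺¹ to
--   the antipodal lift  f(1,x) = 𝟙ℬ(x),  f(0,x) = −𝟙ℬ(xᶜ)   (nondecreasing, antipodal),
--   the family          𝓘 = {(t,x) : x ∉ 𝒜}                  (decreasing).
-- After normalising by 2^{-(n+1)}, the left side of (*) is ½ μ(ℬ ∖ 𝒜), because f* vanishes
-- where t = 0, and the right side is Σᵢ λᵢ(f) μ(𝓘 ∩ χᵢ) = ½ λ₀(f)(1 − μ𝒜) + Σᵢ λᵢ(𝟙ℬ) μ(𝒜ᶜ ∩ χᵢ),
-- because the lift shifts the spectrum: λᵢ₊₁(f) = λᵢ(𝟙ℬ).  Two identities finish the job: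
--   • spectral mass: for antipodal h, Σᵢ λᵢ(h) = 𝔼[h²] (Parseval, with ĥ(∅) = 𝔼h = 0),
--     so λ₀(f) + Σᵢ λᵢ(𝟙ℬ) = 𝔼[f²] = μ(ℬ);
--   • influence: for increasing 𝒜, μ(𝒜ᶜ ∩ χᵢ) = ½(1 − μ𝒜) − ¼ Iᵢ(𝒜).

open import Defs
open import Data.Nat as ℕ using (ℕ; zero; suc)
open import Data.Fin using (Fin; zero; suc)
open import Data.Bool using (Bool; true; false; not; _∧_; if_then_else_)
open import Data.Bool.Properties using (not-involutive; ∧-comm; ∧-identityʳ; ∧-zeroʳ)
open import Data.Vec as V using ([]; _∷_; lookup; _[_]%=_)
open import Data.Vec.Properties using (map-∘; map-cong; map-id; lookup-map; lookup∘updateAt)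
open import Data.List as L using (List; _++_)
import Data.List.Properties as LP
open import Data.Rational using (ℚ; 0ℚ; 1ℚ; ½; _+_; _*_; -_; _-_; _⊔_; _≤_; NonNegative)
open import Data.Rational.Properties
  using (≤-refl; ≤-trans; _≤?_; +-comm; +-assoc; +-identityˡ; +-identityʳ; *-identityˡ; *-identityʳ; *-zeroʳ; *-distribˡ-+; neg-distribˡ-*;
         +-monoˡ-≤; *-monoˡ-≤-nonNeg; neg-antimono-≤; nonNeg*nonNeg⇒nonNeg)
open import Data.Rational.Solver using (module +-*-Solver)
open +-*-Solver
open import Relation.Binary.PropositionalEquality
  using (_≡_; refl; sym; trans; cong; cong₂; subst₂; module ≡-Reasoning)
open import Relation.Nullary.Decidable using (toWitness)
open import Function using (_∘_; id)

open ≡-Reasoning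

sum-++ : ∀ xs ys → sumℚ (xs ++ ys) ≡ sumℚ xs + sumℚ ys
sum-++ L.[]       ys = sym (+-identityˡ (sumℚ ys))
sum-++ (x L.∷ xs) ys = trans (cong (x +_) (sum-++ xs ys)) (sym (+-assoc x (sumℚ xs) (sumℚ ys)))

module _ {a} {A : Set a} where

  sum-cong : (xs : List A) {f g : A → ℚ} → (∀ x → f x ≡ g x) → sumℚ (L.map f xs) ≡ sumℚ (L.map g xs)
  sum-cong L.[]       h = refl
  sum-cong (x L.∷ xs) h = cong₂ _+_ (h x) (sum-cong xs h)

  sum-+ : (xs : List A) (f g : A → ℚ) →
          sumℚ (L.map (λ x → f x + g x) xs) ≡ sumℚ (L.map f xs) + sumℚ (L.map g xs)
  sum-+ L.[]       f g = refl
  sum-+ (x L.∷ xs) f g = trans (cong (f x + g x +_) (sum-+ xs f g))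
    (solve 4 (λ a b c d → a :+ b :+ (c :+ d) := a :+ c :+ (b :+ d)) refl (f x) (g x) _ _)

  sum-scale : (xs : List A) (c : ℚ) (f : A → ℚ) → sumℚ (L.map (λ x → c * f x) xs) ≡ c * sumℚ (L.map f xs)
  sum-scale L.[]       c f = sym (*-zeroʳ c)
  sum-scale (x L.∷ xs) c f = trans (cong (c * f x +_) (sum-scale xs c f))
    (sym (*-distribˡ-+ c (f x) (sumℚ (L.map f xs))))

  sum-zero : (xs : List A) → sumℚ (L.map (λ _ → 0ℚ) xs) ≡ 0ℚ
  sum-zero L.[]       = refl
  sum-zero (x L.∷ xs) = cong (0ℚ +_) (sum-zero xs)

sum-swap : ∀ {a b} {A : Set a} {B : Set b} (xs : List A) (ys : List B) (G : A → B → ℚ) →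
  sumℚ (L.map (λ x → sumℚ (L.map (G x) ys)) xs) ≡ sumℚ (L.map (λ y → sumℚ (L.map (λ x → G x y) xs)) ys)
sum-swap L.[]       ys G = sym (sum-zero ys)
sum-swap (x L.∷ xs) ys G = trans (cong (sumℚ (L.map (G x) ys) +_) (sum-swap xs ys G))
  (sym (sum-+ ys (G x) (λ y → sumℚ (L.map (λ x → G x y) xs))))

ΣFin-cong : ∀ k {f g : Fin k → ℚ} → (∀ i → f i ≡ g i) → ΣFin k f ≡ ΣFin k g
ΣFin-cong k = sum-cong (L.allFin k)

ΣFin-suc : ∀ k (h : Fin (suc k) → ℚ) → ΣFin (suc k) h ≡ h zero + ΣFin k (λ i → h (suc i))
ΣFin-suc k h = cong (h zero +_) (cong sumℚ
  (trans (LP.map-tabulate suc h) (sym (LP.map-tabulate id (h ∘ suc)))))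

Σcube-split : ∀ m (g : Cube (suc m) → ℚ) →
  Σcube (suc m) g ≡ Σcube m (λ x → g (true ∷ x)) + Σcube m (λ x → g (false ∷ x))
Σcube-split m g = begin
  sumℚ (L.map g (ones ++ zeros))              ≡⟨ cong sumℚ (LP.map-++ g ones zeros) ⟩
  sumℚ (L.map g ones ++ L.map g zeros)        ≡⟨ sum-++ (L.map g ones) (L.map g zeros) ⟩
  sumℚ (L.map g ones) + sumℚ (L.map g zeros)  ≡⟨ cong₂ _+_ (cong sumℚ (sym (LP.map-∘ (allCube m))))
                                                           (cong sumℚ (sym (LP.map-∘ (allCube m)))) ⟩
  Σcube m (λ x → g (true ∷ x)) + Σcube m (λ x → g (false ∷ x)) ∎
  where
  ones  = L.map (true ∷_) (allCube m)
  zeros = L.map (false ∷_) (allCube m)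

𝔼-split : ∀ m (g : Cube (suc m) → ℚ) →
  𝔼 (suc m) g ≡ ½ * (𝔼 m (λ x → g (true ∷ x)) + 𝔼 m (λ x → g (false ∷ x)))
𝔼-split m g = trans (cong (½ * powℚ ½ m *_) (Σcube-split m g))
  (solve 3 (λ p a b → con ½ :* p :* (a :+ b) := con ½ :* (p :* a :+ p :* b)) refl (powℚ ½ m) _ _)

𝔼-cong : ∀ m {f g : Cube m → ℚ} → (∀ x → f x ≡ g x) → 𝔼 m f ≡ 𝔼 m g
𝔼-cong m h = cong (powℚ ½ m *_) (sum-cong (allCube m) h)

𝔼-+ : ∀ m (f g : Cube m → ℚ) → 𝔼 m (λ x → f x + g x) ≡ 𝔼 m f + 𝔼 m g
𝔼-+ m f g = trans (cong (powℚ ½ m *_) (sum-+ (allCube m) f g)) (*-distribˡ-+ (powℚ ½ m) (Σcube m f) (Σcube m g))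

𝔼-scale : ∀ m (c : ℚ) (f : Cube m → ℚ) → 𝔼 m (λ x → c * f x) ≡ c * 𝔼 m f
𝔼-scale m c f = trans (cong (powℚ ½ m *_) (sum-scale (allCube m) c f))
  (solve 3 (λ p c a → p :* (c :* a) := c :* (p :* a)) refl (powℚ ½ m) c _)

𝔼-neg : ∀ m (f : Cube m → ℚ) → 𝔼 m (λ x → - f x) ≡ - 𝔼 m f
𝔼-neg m f = begin
  𝔼 m (λ x → - f x)      ≡⟨ 𝔼-cong m (λ x → solve 1 (λ a → :- a := con (- 1ℚ) :* a) refl (f x)) ⟩
  𝔼 m (λ x → - 1ℚ * f x) ≡⟨ 𝔼-scale m (- 1ℚ) f ⟩
  - 1ℚ * 𝔼 m f           ≡⟨ solve 1 (λ a → con (- 1ℚ) :* a := :- a) refl (𝔼 m f) ⟩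
  - 𝔼 m f                ∎

𝔼-− : ∀ m (f g : Cube m → ℚ) → 𝔼 m (λ x → f x - g x) ≡ 𝔼 m f - 𝔼 m g
𝔼-− m f g = trans (𝔼-+ m f (λ x → - g x)) (cong (𝔼 m f +_) (𝔼-neg m g))

𝔼-const : ∀ m (c : ℚ) → 𝔼 m (λ _ → c) ≡ c
𝔼-const zero    c = trans (*-identityˡ (c + 0ℚ)) (+-identityʳ c)
𝔼-const (suc m) c = begin
  𝔼 (suc m) (λ _ → c)                  ≡⟨ 𝔼-split m (λ _ → c) ⟩
  ½ * (𝔼 m (λ _ → c) + 𝔼 m (λ _ → c))  ≡⟨ cong₂ (λ a b → ½ * (a + b)) (𝔼-const m c) (𝔼-const m c) ⟩
  ½ * (c + c)                          ≡⟨ solve 1 (λ c → con ½ :* (c :+ c) := c) refl c ⟩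
  c                                    ∎

𝔼-ΣFin : ∀ m k (G : Cube m → Fin k → ℚ) → 𝔼 m (λ x → ΣFin k (G x)) ≡ ΣFin k (λ i → 𝔼 m (λ x → G x i))
𝔼-ΣFin m k G = trans (cong (powℚ ½ m *_) (sum-swap (allCube m) (L.allFin k) G))
  (sym (sum-scale (L.allFin k) (powℚ ½ m) _))

𝔼-complement : ∀ m (g : Cube m → ℚ) → 𝔼 m (λ x → g (V.map not x)) ≡ 𝔼 m g
𝔼-complement zero    g = refl
𝔼-complement (suc m) g = begin
  𝔼 (suc m) (λ x → g (V.map not x))
    ≡⟨ 𝔼-split m _ ⟩
  ½ * (𝔼 m (λ x → g (false ∷ V.map not x)) + 𝔼 m (λ x → g (true ∷ V.map not x)))
    ≡⟨ cong₂ (λ a b → ½ * (a + b)) (𝔼-complement m (λ x → g (false ∷ x))) (𝔼-complement m (λ x → g (true ∷ x))) ⟩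
  ½ * (𝔼 m (λ x → g (false ∷ x)) + 𝔼 m (λ x → g (true ∷ x)))
    ≡⟨ cong (½ *_) (+-comm (𝔼 m (λ x → g (false ∷ x))) (𝔼 m (λ x → g (true ∷ x)))) ⟩
  ½ * (𝔼 m (λ x → g (true ∷ x)) + 𝔼 m (λ x → g (false ∷ x)))
    ≡⟨ sym (𝔼-split m g) ⟩
  𝔼 (suc m) g ∎

𝔼-flip : ∀ m (i : Fin m) (g : Cube m → ℚ) → 𝔼 m (λ x → g (x [ i ]%= not)) ≡ 𝔼 m g
𝔼-flip (suc m) zero    g = trans (𝔼-split m _) (trans
  (cong (½ *_) (+-comm (𝔼 m (λ x → g (false ∷ x))) (𝔼 m (λ x → g (true ∷ x)))))
  (sym (𝔼-split m g)))
𝔼-flip (suc m) (suc i) g = trans (𝔼-split m _) (trans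
  (cong₂ (λ a b → ½ * (a + b)) (𝔼-flip m i (λ x → g (true ∷ x))) (𝔼-flip m i (λ x → g (false ∷ x))))
  (sym (𝔼-split m g)))

𝔼-mono : ∀ m (f g : Cube m → ℚ) → Σcube m f ≤ Σcube m g → 𝔼 m f ≤ 𝔼 m g
𝔼-mono m f g = *-monoˡ-≤-nonNeg (powℚ ½ m) {{weight-nonNeg m}}
  where
  weight-nonNeg : ∀ m → NonNegative (powℚ ½ m)
  weight-nonNeg zero    = _
  weight-nonNeg (suc m) = nonNeg*nonNeg⇒nonNeg ½ (powℚ ½ m) {{weight-nonNeg m}}

μ-cong : ∀ m {F G : Family m} → (∀ x → F x ≡ G x) → μ m F ≡ μ m G
μ-cong m h = 𝔼-cong m (λ x → cong ind (h x))

μ-complement : ∀ m (F : Family m) → μ m (λ x → not (F x)) ≡ 1ℚ - μ m F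
μ-complement m F = begin
  μ m (λ x → not (F x))         ≡⟨ 𝔼-cong m (λ x → ind-not (F x)) ⟩
  𝔼 m (λ x → 1ℚ - ind (F x))    ≡⟨ 𝔼-− m (λ _ → 1ℚ) (𝟙 F) ⟩
  𝔼 m (λ _ → 1ℚ) - μ m F        ≡⟨ cong (_- μ m F) (𝔼-const m 1ℚ) ⟩
  1ℚ - μ m F                    ∎
  where
  ind-not : ∀ a → ind (not a) ≡ 1ℚ - ind a
  ind-not true  = refl
  ind-not false = refl

μ-partition : ∀ m (F G : Family m) → μ m F ≡ μ m (F ∩ G) + μ m (λ x → F x ∧ not (G x))
μ-partition m F G = trans (𝔼-cong m (λ x → ind-split (F x) (G x)))
  (𝔼-+ m (𝟙 (F ∩ G)) (λ x → ind (F x ∧ not (G x))))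
  where
  ind-split : ∀ a b → ind a ≡ ind (a ∧ b) + ind (a ∧ not b)
  ind-split true  true  = refl
  ind-split true  false = refl
  ind-split false true  = refl
  ind-split false false = refl

μ-coordinate : ∀ m (i : Fin m) → μ m (λ x → lookup x i) ≡ ½
μ-coordinate (suc m) zero = begin
  μ (suc m) (λ x → lookup x zero)         ≡⟨ 𝔼-split m _ ⟩
  ½ * (𝔼 m (λ _ → 1ℚ) + 𝔼 m (λ _ → 0ℚ))  ≡⟨ cong₂ (λ a b → ½ * (a + b)) (𝔼-const m 1ℚ) (𝔼-const m 0ℚ) ⟩
  ½ * (1ℚ + 0ℚ)                          ≡⟨⟩
  ½                                      ∎
μ-coordinate (suc m) (suc i) = trans (𝔼-split m _) (trans
  (cong₂ (λ a b → ½ * (a + b)) (μ-coordinate m i) (μ-coordinate m i))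
  refl)

emptySet fullSet : ∀ m → Cube m
emptySet m = V.replicate m false
fullSet  m = V.replicate m true

sign : Bool → ℚ
sign b = if b then - 1ℚ else 1ℚ

sign-sq : ∀ b → sq (sign b) ≡ 1ℚ
sign-sq true  = refl
sign-sq false = refl

u-empty : ∀ {m} (T : Cube m) → u (emptySet m) T ≡ 1ℚ
u-empty []      = refl
u-empty (t ∷ T) = cong (1ℚ *_) (u-empty T)

fhat-empty : ∀ m (h : Cube m → ℚ) → fhat m h (emptySet m) ≡ 𝔼 m h
fhat-empty m h = 𝔼-cong m (λ T → trans (cong (h T *_) (u-empty T)) (*-identityʳ (h T)))

𝔼-pull : ∀ m (c : ℚ) (k l : Cube m → ℚ) → 𝔼 m (λ x → k x * (c * l x)) ≡ c * 𝔼 m (λ x → k x * l x)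
𝔼-pull m c k l = trans (𝔼-cong m (λ x → solve 3 (λ c a b → a :* (c :* b) := c :* (a :* b)) refl c (k x) (l x)))
  (𝔼-scale m c _)

unit-factor : ∀ m (k : Cube m → ℚ) S → 𝔼 m (λ x → k x * (1ℚ * u S x)) ≡ fhat m k S
unit-factor m k S = 𝔼-cong m (λ x → cong (k x *_) (*-identityˡ (u S x)))

fhat-split : ∀ m (h : Cube (suc m) → ℚ) s S →
  fhat (suc m) h (s ∷ S) ≡ ½ * (sign s * fhat m (λ x → h (true ∷ x)) S + fhat m (λ x → h (false ∷ x)) S)
fhat-split m h true  S = trans (𝔼-split m _)
  (cong₂ (λ a b → ½ * (a + b)) (𝔼-pull m (sign true) (λ x → h (true ∷ x)) (u S)) (unit-factor m (λ x → h (false ∷ x)) S))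
fhat-split m h false S = trans (𝔼-split m _)
  (cong₂ (λ a b → ½ * (a + b)) (𝔼-pull m (sign false) (λ x → h (true ∷ x)) (u S)) (unit-factor m (λ x → h (false ∷ x)) S))

parseval : ∀ m (h : Cube m → ℚ) → Σcube m (λ S → sq (fhat m h S)) ≡ 𝔼 m (λ T → sq (h T))
parseval zero    h = solve 1 (λ a → (con 1ℚ :* (a :* con 1ℚ :+ con 0ℚ)) :* (con 1ℚ :* (a :* con 1ℚ :+ con 0ℚ)) :+ con 0ℚ
                                   := con 1ℚ :* (a :* a :+ con 0ℚ)) refl (h [])
parseval (suc m) h = begin
  Σcube (suc m) (λ S → sq (ĥ S))
    ≡⟨ Σcube-split m (λ S → sq (ĥ S)) ⟩
  Σcube m (λ S → sq (ĥ (true ∷ S))) + Σcube m (λ S → sq (ĥ (false ∷ S)))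
    ≡⟨ sym (sum-+ (allCube m) (λ S → sq (ĥ (true ∷ S))) (λ S → sq (ĥ (false ∷ S)))) ⟩
  Σcube m (λ S → sq (ĥ (true ∷ S)) + sq (ĥ (false ∷ S)))
    ≡⟨ sum-cong (allCube m) pair ⟩
  Σcube m (λ S → ½ * (sq (fhat m h₁ S) + sq (fhat m h₀ S)))
    ≡⟨ sum-scale (allCube m) ½ (λ S → sq (fhat m h₁ S) + sq (fhat m h₀ S)) ⟩
  ½ * Σcube m (λ S → sq (fhat m h₁ S) + sq (fhat m h₀ S))
    ≡⟨ cong (½ *_) (sum-+ (allCube m) (λ S → sq (fhat m h₁ S)) (λ S → sq (fhat m h₀ S))) ⟩
  ½ * (Σcube m (λ S → sq (fhat m h₁ S)) + Σcube m (λ S → sq (fhat m h₀ S)))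
    ≡⟨ cong₂ (λ a b → ½ * (a + b)) (parseval m h₁) (parseval m h₀) ⟩
  ½ * (𝔼 m (λ T → sq (h₁ T)) + 𝔼 m (λ T → sq (h₀ T)))
    ≡⟨ sym (𝔼-split m (λ T → sq (h T))) ⟩
  𝔼 (suc m) (λ T → sq (h T)) ∎
  where
  ĥ = fhat (suc m) h
  h₁ = λ x → h (true ∷ x)
  h₀ = λ x → h (false ∷ x)
  -- ((−a + b)/2)² + ((a + b)/2)² = (a² + b²)/2
  pair : ∀ S → sq (ĥ (true ∷ S)) + sq (ĥ (false ∷ S)) ≡ ½ * (sq (fhat m h₁ S) + sq (fhat m h₀ S))
  pair S = trans (cong₂ (λ x y → sq x + sq y) (fhat-split m h true S) (fhat-split m h false S))
    (solve 2 (λ a b → (con ½ :* (con (- 1ℚ) :* a :+ b)) :* (con ½ :* (con (- 1ℚ) :* a :+ b))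
                      :+ (con ½ :* (con 1ℚ :* a :+ b)) :* (con ½ :* (con 1ℚ :* a :+ b))
                      := con ½ :* (a :* a :+ b :* b)) refl (fhat m h₁ S) (fhat m h₀ S))

atMax : ∀ {k} → Cube k → ℚ → Fin k → ℚ
atMax S v i = if isMax S i then v else 0ℚ

-- Every set is either empty or has a unique maximum, so a value v splits accordingly.
empty-or-max : ∀ {m} (S : Cube m) (v : ℚ) → v ≡ (if allFalse S then v else 0ℚ) + ΣFin m (atMax S v)
empty-or-max []      v = sym (+-identityʳ v)
empty-or-max {suc m} (true ∷ S) v = begin
  v                                           ≡⟨ empty-or-max S v ⟩
  (if allFalse S then v else 0ℚ) + ΣFin m (atMax S v)
    ≡⟨ sym (+-identityˡ _) ⟩
  0ℚ + ((if allFalse S then v else 0ℚ) + ΣFin m (atMax S v))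
    ≡⟨ cong (0ℚ +_) (sym (ΣFin-suc m (atMax (true ∷ S) v))) ⟩
  0ℚ + ΣFin (suc m) (atMax (true ∷ S) v)       ∎
empty-or-max {suc m} (false ∷ S) v = begin
  v                                           ≡⟨ empty-or-max S v ⟩
  (if allFalse S then v else 0ℚ) + ΣFin m (atMax S v)
    ≡⟨ cong ((if allFalse S then v else 0ℚ) +_) (sym (+-identityˡ _)) ⟩
  (if allFalse S then v else 0ℚ) + (0ℚ + ΣFin m (atMax S v))
    ≡⟨ cong ((if allFalse S then v else 0ℚ) +_) (sym (ΣFin-suc m (atMax (false ∷ S) v))) ⟩
  (if allFalse S then v else 0ℚ) + ΣFin (suc m) (atMax (false ∷ S) v) ∎

Σ-only-empty : ∀ m (g : Cube m → ℚ) → Σcube m (λ S → if allFalse S then g S else 0ℚ) ≡ g (emptySet m)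
Σ-only-empty zero    g = +-identityʳ (g [])
Σ-only-empty (suc m) g = begin
  Σcube (suc m) (λ S → if allFalse S then g S else 0ℚ)
    ≡⟨ Σcube-split m _ ⟩
  Σcube m (λ _ → 0ℚ) + Σcube m (λ S → if allFalse S then g (false ∷ S) else 0ℚ)
    ≡⟨ cong₂ _+_ (sum-zero (allCube m)) (Σ-only-empty m (λ S → g (false ∷ S))) ⟩
  0ℚ + g (emptySet (suc m))
    ≡⟨ +-identityˡ _ ⟩
  g (emptySet (suc m)) ∎

Σ-by-max : ∀ m (g : Cube m → ℚ) → Σcube m g ≡ g (emptySet m) + ΣFin m (λ i → Σcube m (λ S → atMax S (g S) i))
Σ-by-max m g = begin
  Σcube m g
    ≡⟨ sum-cong (allCube m) (λ S → empty-or-max S (g S)) ⟩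
  Σcube m (λ S → (if allFalse S then g S else 0ℚ) + ΣFin m (atMax S (g S)))
    ≡⟨ sum-+ (allCube m) _ _ ⟩
  Σcube m (λ S → if allFalse S then g S else 0ℚ) + Σcube m (λ S → ΣFin m (atMax S (g S)))
    ≡⟨ cong₂ _+_ (Σ-only-empty m g) (sum-swap (allCube m) (L.allFin m) (λ S → atMax S (g S))) ⟩
  g (emptySet m) + ΣFin m (λ i → Σcube m (λ S → atMax S (g S) i)) ∎

-- An antipodal function has mean zero, since 𝔼h = 𝔼[h ∘ ᶜ] = −𝔼h.
antipodal-mean : ∀ m (h : Cube m → ℚ) → Antipodal h → 𝔼 m h ≡ 0ℚ
antipodal-mean m h anti = self-negative (begin
  𝔼 m h                       ≡⟨ sym (𝔼-complement m h) ⟩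
  𝔼 m (λ x → h (V.map not x)) ≡⟨ 𝔼-cong m anti ⟩
  𝔼 m (λ x → - h x)           ≡⟨ 𝔼-neg m h ⟩
  - 𝔼 m h                     ∎)
  where
  self-negative : ∀ {a} → a ≡ - a → a ≡ 0ℚ
  self-negative {a} e = begin
    a              ≡⟨ solve 1 (λ a → a := con ½ :* (a :+ a)) refl a ⟩
    ½ * (a + a)    ≡⟨ cong (λ b → ½ * (a + b)) e ⟩
    ½ * (a + - a)  ≡⟨ solve 1 (λ a → con ½ :* (a :+ :- a) := con 0ℚ) refl a ⟩
    0ℚ             ∎

spectral-mass : ∀ m (h : Cube m → ℚ) → Antipodal h → ΣFin m (lam m h) ≡ 𝔼 m (λ x → sq (h x))
spectral-mass m h anti = begin
  ΣFin m (lam m h)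
    ≡⟨ sym (+-identityˡ _) ⟩
  0ℚ + ΣFin m (lam m h)
    ≡⟨ cong (λ a → sq a + ΣFin m (lam m h)) (sym (trans (fhat-empty m h) (antipodal-mean m h anti))) ⟩
  sq (fhat m h (emptySet m)) + ΣFin m (lam m h)
    ≡⟨ sym (Σ-by-max m (λ S → sq (fhat m h S))) ⟩
  Σcube m (λ S → sq (fhat m h S))
    ≡⟨ parseval m h ⟩
  𝔼 m (λ x → sq (h x)) ∎

complement-involutive : ∀ {m} (x : Cube m) → V.map not (V.map not x) ≡ x
complement-involutive x = trans (sym (map-∘ not not x)) (trans (map-cong not-involutive x) (map-id x))

u-complement : ∀ {m} (S T : Cube m) → u S (V.map not T) ≡ u S (fullSet m) * u S T
u-complement []      []      = refl
u-complement (s ∷ S) (t ∷ T) = begin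
  sign (s ∧ not t) * u S (V.map not T)
    ≡⟨ cong₂ _*_ (sign-complement s t) (u-complement S T) ⟩
  (sign (s ∧ true) * sign (s ∧ t)) * (u S (fullSet _) * u S T)
    ≡⟨ solve 4 (λ a b c d → (a :* b) :* (c :* d) := (a :* c) :* (b :* d)) refl
         (sign (s ∧ true)) (sign (s ∧ t)) (u S (fullSet _)) (u S T) ⟩
  (sign (s ∧ true) * u S (fullSet _)) * (sign (s ∧ t) * u S T) ∎
  where
  sign-complement : ∀ s t → sign (s ∧ not t) ≡ sign (s ∧ true) * sign (s ∧ t)
  sign-complement true  true  = refl
  sign-complement true  false = refl
  sign-complement false t     = refl

u-sq : ∀ {m} (S T : Cube m) → sq (u S T) ≡ 1ℚ
u-sq []      []      = refl
u-sq (s ∷ S) (t ∷ T) = begin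
  sq (sign (s ∧ t) * u S T)
    ≡⟨ solve 2 (λ c x → (c :* x) :* (c :* x) := (c :* c) :* (x :* x)) refl (sign (s ∧ t)) (u S T) ⟩
  sq (sign (s ∧ t)) * sq (u S T)
    ≡⟨ cong₂ _*_ (sign-sq (s ∧ t)) (u-sq S T) ⟩
  1ℚ ∎

fhat-complement : ∀ m (h : Cube m → ℚ) S → fhat m (λ x → h (V.map not x)) S ≡ u S (fullSet m) * fhat m h S
fhat-complement m h S = begin
  𝔼 m (λ T → h (V.map not T) * u S T)
    ≡⟨ 𝔼-cong m (λ T → cong (λ z → h (V.map not T) * u S z) (sym (complement-involutive T))) ⟩
  𝔼 m (λ T → F (V.map not T))
    ≡⟨ 𝔼-complement m F ⟩
  𝔼 m F
    ≡⟨ 𝔼-cong m (λ T → trans (cong (h T *_) (u-complement S T))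
                     (solve 3 (λ a s v → a :* (s :* v) := s :* (a :* v)) refl (h T) (u S (fullSet m)) (u S T))) ⟩
  𝔼 m (λ T → u S (fullSet m) * (h T * u S T))
    ≡⟨ 𝔼-scale m (u S (fullSet m)) _ ⟩
  u S (fullSet m) * fhat m h S ∎
  where
  F : Cube m → ℚ
  F T = h T * u S (V.map not T)

fhat-neg : ∀ m (h : Cube m → ℚ) S → fhat m (λ x → - h x) S ≡ - fhat m h S
fhat-neg m h S = trans (𝔼-cong m (λ T → sym (neg-distribˡ-* (h T) (u S T))))
  (𝔼-neg m (λ T → h T * u S T))

tail-⊆ : ∀ {m} {b c} {x y : Cube m} → (b ∷ x) ⊆ (c ∷ y) → x ⊆ y
tail-⊆ p i = p (suc i)

not-antitone : ∀ a b → (a ≡ true → b ≡ true) → not b ≡ true → not a ≡ true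
not-antitone false _     _   _  = refl
not-antitone true  true  _   ()
not-antitone true  false a⇒b _ with a⇒b refl
... | ()

complement-antitone : ∀ {m} (x y : Cube m) → x ⊆ y → V.map not y ⊆ V.map not x
complement-antitone x y p i h = trans (lookup-map i not x)
  (not-antitone _ _ (p i) (trans (sym (lookup-map i not y)) h))

flip-below : ∀ {m} (x : Cube m) i → lookup x i ≡ true → (x [ i ]%= not) ⊆ x
flip-below (b ∷ x) zero    h zero    _ = h
flip-below (b ∷ x) zero    h (suc j) e = e
flip-below (b ∷ x) (suc i) h zero    e = e
flip-below (b ∷ x) (suc i) h (suc j) e = flip-below x i h j e

flip-above : ∀ {m} (x : Cube m) i → lookup x i ≡ false → x ⊆ (x [ i ]%= not)
flip-above (true  ∷ x) zero    () zero    _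
flip-above (false ∷ x) zero    h  zero    ()
flip-above (b ∷ x)     zero    h  (suc j) e = e
flip-above (b ∷ x)     (suc i) h  zero    e = e
flip-above (b ∷ x)     (suc i) h  (suc j) e = flip-above x i h j e

ind-nonneg : ∀ a → 0ℚ ≤ ind a
ind-nonneg true  = toWitness {a? = 0ℚ ≤? 1ℚ} _
ind-nonneg false = ≤-refl

indicator-nondecreasing : ∀ {m} {ℬ : Family m} → Increasing ℬ → Nondecreasing (𝟙 ℬ)
indicator-nondecreasing {ℬ = ℬ} inc x y p = ind-mono (ℬ x) (ℬ y) (inc x y p)
  where
  ind-mono : ∀ a b → (a ≡ true → b ≡ true) → ind a ≤ ind b
  ind-mono false b     _   = ind-nonneg b
  ind-mono true  true  _   = ≤-refl
  ind-mono true  false a⇒b with a⇒b refl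
  ... | ()

lift : ∀ {n} → (Cube n → ℚ) → Cube (suc n) → ℚ
lift g (true  ∷ x) = g x
lift g (false ∷ x) = - g (V.map not x)

lift-antipodal : ∀ {n} (g : Cube n → ℚ) → Antipodal (lift g)
lift-antipodal g (true  ∷ x) = cong (λ y → - g y) (complement-involutive x)
lift-antipodal g (false ∷ x) = solve 1 (λ a → a := :- (:- a)) refl (g (V.map not x))

lift-nondecreasing : ∀ {n} (g : Cube n → ℚ) → Nondecreasing g → (∀ x → 0ℚ ≤ g x) → Nondecreasing (lift g)
lift-nondecreasing g mono nonneg (true  ∷ x) (true  ∷ y) p = mono x y (tail-⊆ p)
lift-nondecreasing g mono nonneg (true  ∷ x) (false ∷ y) p with p zero refl
... | ()
lift-nondecreasing g mono nonneg (false ∷ x) (true  ∷ y) p = ≤-trans (neg-antimono-≤ (nonneg (V.map not x))) (nonneg y)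
lift-nondecreasing g mono nonneg (false ∷ x) (false ∷ y) p =
  neg-antimono-≤ (mono (V.map not y) (V.map not x) (complement-antitone x y (tail-⊆ p)))

-- The lift has the same energy 𝔼[·²] as g, complementation being measure preserving.
lift-energy : ∀ n (g : Cube n → ℚ) → 𝔼 (suc n) (λ z → sq (lift g z)) ≡ 𝔼 n (λ x → sq (g x))
lift-energy n g = begin
  𝔼 (suc n) (λ z → sq (lift g z))
    ≡⟨ 𝔼-split n _ ⟩
  ½ * (𝔼 n (λ x → sq (g x)) + 𝔼 n (λ x → sq (- g (V.map not x))))
    ≡⟨ cong (λ b → ½ * (𝔼 n (λ x → sq (g x)) + b))
         (trans (𝔼-cong n (λ x → solve 1 (λ a → (:- a) :* (:- a) := a :* a) refl (g (V.map not x))))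
                (𝔼-complement n (λ x → sq (g x)))) ⟩
  ½ * (𝔼 n (λ x → sq (g x)) + 𝔼 n (λ x → sq (g x)))
    ≡⟨ solve 1 (λ a → con ½ :* (a :+ a) := a) refl _ ⟩
  𝔼 n (λ x → sq (g x)) ∎

lift-fhat : ∀ n (g : Cube n → ℚ) s S →
  fhat (suc n) (lift g) (s ∷ S) ≡ ½ * (sign s * fhat n g S + - (u S (fullSet n) * fhat n g S))
lift-fhat n g s S = trans (fhat-split n (lift g) s S)
  (cong (λ b → ½ * (sign s * fhat n g S + b))
        (trans (fhat-neg n (λ x → g (V.map not x)) S) (cong -_ (fhat-complement n g S))))

if-+ : ∀ b (x y : ℚ) → (if b then x else 0ℚ) + (if b then y else 0ℚ) ≡ (if b then x + y else 0ℚ)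
if-+ true  x y = refl
if-+ false x y = refl

lift-lam : ∀ n (g : Cube n → ℚ) i → lam (suc n) (lift g) (suc i) ≡ lam n g i
lift-lam n g i = begin
  lam (suc n) (lift g) (suc i)
    ≡⟨ Σcube-split n _ ⟩
  Σcube n (λ S → if isMax S i then sq (f̂ (true ∷ S)) else 0ℚ) + Σcube n (λ S → if isMax S i then sq (f̂ (false ∷ S)) else 0ℚ)
    ≡⟨ sym (sum-+ (allCube n) _ _) ⟩
  Σcube n (λ S → (if isMax S i then sq (f̂ (true ∷ S)) else 0ℚ) + (if isMax S i then sq (f̂ (false ∷ S)) else 0ℚ))
    ≡⟨ sum-cong (allCube n) (λ S → trans (if-+ (isMax S i) _ _) (cong (λ v → if isMax S i then v else 0ℚ) (pair S))) ⟩
  lam n g i ∎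
  where
  f̂ = fhat (suc n) (lift g)
  -- ¼(−a − σa)² + ¼(a − σa)² = ½(1 + σ²) a² = a², as σ = u_S([n]) = ±1.
  pair : ∀ S → sq (f̂ (true ∷ S)) + sq (f̂ (false ∷ S)) ≡ sq (fhat n g S)
  pair S = begin
    sq (f̂ (true ∷ S)) + sq (f̂ (false ∷ S))
      ≡⟨ cong₂ (λ x y → sq x + sq y) (lift-fhat n g true S) (lift-fhat n g false S) ⟩
    sq (½ * (- 1ℚ * a + - (σ * a))) + sq (½ * (1ℚ * a + - (σ * a)))
      ≡⟨ solve 2 (λ a σ → (con ½ :* (con (- 1ℚ) :* a :+ :- (σ :* a))) :* (con ½ :* (con (- 1ℚ) :* a :+ :- (σ :* a)))
                        :+ (con ½ :* (con 1ℚ :* a :+ :- (σ :* a))) :* (con ½ :* (con 1ℚ :* a :+ :- (σ :* a)))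
                        := con ½ :* (a :* a :+ (σ :* σ) :* (a :* a))) refl a σ ⟩
    ½ * (sq a + sq σ * sq a)
      ≡⟨ cong (λ z → ½ * (sq a + z * sq a)) (u-sq S (fullSet n)) ⟩
    ½ * (sq a + 1ℚ * sq a)
      ≡⟨ solve 1 (λ a → con ½ :* (a :+ con 1ℚ :* a) := a) refl (sq a) ⟩
    sq a ∎
    where
    a = fhat n g S
    σ = u S (fullSet n)

lift-spectrum : ∀ n (g : Cube n → ℚ) → lam (suc n) (lift g) zero + ΣFin n (lam n g) ≡ 𝔼 n (λ x → sq (g x))
lift-spectrum n g = begin
  lam (suc n) (lift g) zero + ΣFin n (lam n g)
    ≡⟨ cong (lam (suc n) (lift g) zero +_) (sym (ΣFin-cong n (lift-lam n g))) ⟩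
  lam (suc n) (lift g) zero + ΣFin n (λ i → lam (suc n) (lift g) (suc i))
    ≡⟨ sym (ΣFin-suc n (lam (suc n) (lift g))) ⟩
  ΣFin (suc n) (lam (suc n) (lift g))
    ≡⟨ spectral-mass (suc n) (lift g) (lift-antipodal g) ⟩
  𝔼 (suc n) (λ z → sq (lift g z))
    ≡⟨ lift-energy n g ⟩
  𝔼 n (λ x → sq (g x)) ∎

-- For increasing 𝒜, x ∈ 𝒜 with x ⊕ eᵢ ∉ 𝒜 forces i ∈ x, and then x ⊕ eᵢ ∈ 𝒜 implies x ∈ 𝒜.
boundary-indicator : ∀ (a a′ l : Bool) → (l ≡ true → a′ ≡ true → a ≡ true) → (l ≡ false → a ≡ true → a′ ≡ true) →
  ind (a ∧ not a′) ≡ ind (a ∧ l) - ind (a′ ∧ l)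
boundary-indicator true  true  true  _ _ = refl
boundary-indicator true  false true  _ _ = refl
boundary-indicator false true  true  down _ with down refl refl
... | ()
boundary-indicator false false true  _ _ = refl
boundary-indicator true  true  false _ _ = refl
boundary-indicator true  false false _ up with up refl refl
... | ()
boundary-indicator false true  false _ _ = refl
boundary-indicator false false false _ _ = refl

boundary-measure : ∀ n (𝒜 : Family n) → Increasing 𝒜 → ∀ i →
  μ n (λ x → 𝒜 x ∧ not (𝒜 (x [ i ]%= not))) ≡ μ n (λ x → 𝒜 x ∧ lookup x i) - μ n (λ x → 𝒜 x ∧ not (lookup x i))
boundary-measure n 𝒜 inc i = begin
  μ n (λ x → 𝒜 x ∧ not (𝒜 (flip x)))
    ≡⟨ 𝔼-cong n (λ x → boundary-indicator (𝒜 x) (𝒜 (flip x)) (lookup x i)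
                         (λ l → inc (flip x) x (flip-below x i l)) (λ l → inc x (flip x) (flip-above x i l))) ⟩
  𝔼 n (λ x → ind (𝒜 x ∧ lookup x i) - ind (𝒜 (flip x) ∧ lookup x i))
    ≡⟨ 𝔼-− n _ _ ⟩
  μ n (λ x → 𝒜 x ∧ lookup x i) - μ n (λ x → 𝒜 (flip x) ∧ lookup x i)
    ≡⟨ cong (λ b → μ n (λ x → 𝒜 x ∧ lookup x i) - b) flipped ⟩
  μ n (λ x → 𝒜 x ∧ lookup x i) - μ n (λ x → 𝒜 x ∧ not (lookup x i)) ∎
  where
  flip : Cube n → Cube n
  flip x = x [ i ]%= not
  flipped : μ n (λ x → 𝒜 (flip x) ∧ lookup x i) ≡ μ n (λ x → 𝒜 x ∧ not (lookup x i))
  flipped = trans (μ-cong n (λ x → cong (𝒜 (flip x) ∧_) (sym (trans (cong not (lookup∘updateAt i {f = not} x)) (not-involutive (lookup x i))))))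
                  (𝔼-flip n i (λ x → ind (𝒜 x ∧ not (lookup x i))))

outside-coordinate : ∀ n (𝒜 : Family n) → Increasing 𝒜 → ∀ i →
  μ n (λ x → not (𝒜 x) ∧ lookup x i) ≡ ½ * (1ℚ - μ n 𝒜) - ½ * ½ * Infl n 𝒜 i
outside-coordinate n 𝒜 inc i = begin
  μ n (λ x → not (𝒜 x) ∧ lookup x i)
    ≡⟨ μ-cong n (λ x → ∧-comm (not (𝒜 x)) (lookup x i)) ⟩
  μ n (λ x → lookup x i ∧ not (𝒜 x))
    ≡⟨ solve 2 (λ c r → r := (c :+ r) :- c) refl (μ n (χ ∩ 𝒜)) _ ⟩
  (μ n (χ ∩ 𝒜) + μ n (λ x → lookup x i ∧ not (𝒜 x))) - μ n (χ ∩ 𝒜)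
    ≡⟨ cong₂ _-_ (trans (sym (μ-partition n χ 𝒜)) (μ-coordinate n i)) (μ-cong n (λ x → ∧-comm (lookup x i) (𝒜 x))) ⟩
  ½ - a₁
    ≡⟨ solve 2 (λ a₁ a₀ → con ½ :- a₁
                 := con ½ :* (con 1ℚ :- (a₁ :+ a₀)) :- con ½ :* con ½ :* ((con 1ℚ :+ con 1ℚ) :* (a₁ :- a₀))) refl a₁ a₀ ⟩
  ½ * (1ℚ - (a₁ + a₀)) - ½ * ½ * ((1ℚ + 1ℚ) * (a₁ - a₀))
    ≡⟨ cong₂ (λ a p → ½ * (1ℚ - a) - ½ * ½ * ((1ℚ + 1ℚ) * p)) (sym (μ-partition n 𝒜 χ)) (sym (boundary-measure n 𝒜 inc i)) ⟩
  ½ * (1ℚ - μ n 𝒜) - ½ * ½ * Infl n 𝒜 i ∎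
  where
  χ : Family n
  χ x = lookup x i
  a₁ a₀ : ℚ
  a₁ = μ n (𝒜 ∩ χ)
  a₀ = μ n (λ x → 𝒜 x ∧ not (χ x))

if-as-ind : ∀ b (v : ℚ) → (if b then v else 0ℚ) ≡ v * ind b
if-as-ind true  v = sym (*-identityʳ v)
if-as-ind false v = sym (*-zeroʳ v)

ftilde-mass : ∀ m (𝓘 : Family m) (h : Cube m → ℚ) →
  𝔼 m (λ x → if 𝓘 x then ftilde m h x else 0ℚ) ≡ ΣFin m (λ i → lam m h i * μ m (λ x → 𝓘 x ∧ lookup x i))
ftilde-mass m 𝓘 h = begin
  𝔼 m (λ x → if 𝓘 x then ftilde m h x else 0ℚ)
    ≡⟨ 𝔼-cong m (λ x → restrict (𝓘 x) x) ⟩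
  𝔼 m (λ x → ΣFin m (λ i → lam m h i * ind (𝓘 x ∧ lookup x i)))
    ≡⟨ 𝔼-ΣFin m m _ ⟩
  ΣFin m (λ i → 𝔼 m (λ x → lam m h i * ind (𝓘 x ∧ lookup x i)))
    ≡⟨ ΣFin-cong m (λ i → 𝔼-scale m (lam m h i) _) ⟩
  ΣFin m (λ i → lam m h i * μ m (λ x → 𝓘 x ∧ lookup x i)) ∎
  where
  restrict : ∀ b x → (if b then ftilde m h x else 0ℚ) ≡ ΣFin m (λ i → lam m h i * ind (b ∧ lookup x i))
  restrict true  x = ΣFin-cong m (λ i → if-as-ind (lookup x i) (lam m h i))
  restrict false x = sym (trans (ΣFin-cong m (λ i → *-zeroʳ (lam m h i))) (sum-zero (L.allFin m)))

outside : ∀ {n} → Family n → Family (suc n)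
outside 𝒜 (t ∷ x) = not (𝒜 x)

outside-decreasing : ∀ {n} {𝒜 : Family n} → Increasing 𝒜 → Decreasing (outside 𝒜)
outside-decreasing {𝒜 = 𝒜} inc (t ∷ x) (s ∷ y) p = not-antitone (𝒜 x) (𝒜 y) (inc x y (tail-⊆ p))

-- Left side of (*): f* = (f⁺)² equals 𝟙ℬ on {t = 1} and vanishes on {t = 0}.
star-left : ∀ n (𝒜 ℬ : Family n) →
  𝔼 (suc n) (λ z → if outside 𝒜 z then fstar (lift (𝟙 ℬ)) z else 0ℚ) ≡ ½ * (μ n ℬ - μ n (𝒜 ∩ ℬ))
star-left n 𝒜 ℬ = begin
  𝔼 (suc n) (λ z → if outside 𝒜 z then fstar (lift (𝟙 ℬ)) z else 0ℚ)
    ≡⟨ 𝔼-split n _ ⟩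
  ½ * (𝔼 n (λ x → if not (𝒜 x) then sq (ind (ℬ x) ⊔ 0ℚ) else 0ℚ)
     + 𝔼 n (λ x → if not (𝒜 x) then sq (- ind (ℬ (V.map not x)) ⊔ 0ℚ) else 0ℚ))
    ≡⟨ cong₂ (λ a b → ½ * (a + b))
         (trans (𝔼-cong n (λ x → positive-part (𝒜 x) (ℬ x))) (𝔼-− n (𝟙 ℬ) (𝟙 (𝒜 ∩ ℬ))))
         (trans (𝔼-cong n (λ x → negative-part (𝒜 x) (ℬ (V.map not x)))) (𝔼-const n 0ℚ)) ⟩
  ½ * ((μ n ℬ - μ n (𝒜 ∩ ℬ)) + 0ℚ)
    ≡⟨ cong (½ *_) (+-identityʳ (μ n ℬ - μ n (𝒜 ∩ ℬ))) ⟩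
  ½ * (μ n ℬ - μ n (𝒜 ∩ ℬ)) ∎
  where
  positive-part : ∀ a b → (if not a then sq (ind b ⊔ 0ℚ) else 0ℚ) ≡ ind b - ind (a ∧ b)
  positive-part true  true  = refl
  positive-part true  false = refl
  positive-part false true  = refl
  positive-part false false = refl
  negative-part : ∀ a b → (if not a then sq (- ind b ⊔ 0ℚ) else 0ℚ) ≡ 0ℚ
  negative-part true  b     = refl
  negative-part false true  = refl
  negative-part false false = refl

-- Right side of (*): the new coordinate contributes λ₀ μ(𝓘 ∩ χ₀) = ½ λ₀ (1 − μ𝒜),
-- the old coordinate i contributes λᵢ(𝟙ℬ) μ(𝒜ᶜ ∩ χᵢ).
star-right : ∀ n (𝒜 ℬ : Family n) →
  𝔼 (suc n) (λ z → if outside 𝒜 z then ftilde (suc n) (lift (𝟙 ℬ)) z else 0ℚ)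
    ≡ lam (suc n) (lift (𝟙 ℬ)) zero * (½ * (1ℚ - μ n 𝒜))
      + ΣFin n (λ i → lam n (𝟙 ℬ) i * μ n (λ x → not (𝒜 x) ∧ lookup x i))
star-right n 𝒜 ℬ = begin
  𝔼 (suc n) (λ z → if outside 𝒜 z then ftilde (suc n) f z else 0ℚ)
    ≡⟨ ftilde-mass (suc n) (outside 𝒜) f ⟩
  ΣFin (suc n) (λ i → lam (suc n) f i * μ (suc n) (λ z → outside 𝒜 z ∧ lookup z i))
    ≡⟨ ΣFin-suc n (λ i → lam (suc n) f i * μ (suc n) (λ z → outside 𝒜 z ∧ lookup z i)) ⟩
  lam (suc n) f zero * μ (suc n) (λ z → outside 𝒜 z ∧ lookup z zero)
    + ΣFin n (λ i → lam (suc n) f (suc i) * μ (suc n) (λ z → outside 𝒜 z ∧ lookup z (suc i)))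
    ≡⟨ cong₂ _+_ (cong (lam (suc n) f zero *_) front)
                 (ΣFin-cong n (λ i → cong₂ _*_ (lift-lam n (𝟙 ℬ) i) (old i))) ⟩
  lam (suc n) f zero * (½ * (1ℚ - μ n 𝒜)) + ΣFin n (λ i → lam n (𝟙 ℬ) i * μ n (λ x → not (𝒜 x) ∧ lookup x i)) ∎
  where
  f = lift (𝟙 ℬ)
  front : μ (suc n) (λ z → outside 𝒜 z ∧ lookup z zero) ≡ ½ * (1ℚ - μ n 𝒜)
  front = trans (𝔼-split n _) (trans
    (cong₂ (λ a b → ½ * (a + b))
      (trans (μ-cong n (λ x → ∧-identityʳ (not (𝒜 x)))) (μ-complement n 𝒜))
      (trans (μ-cong n (λ x → ∧-zeroʳ (not (𝒜 x)))) (𝔼-const n 0ℚ)))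
    (cong (½ *_) (+-identityʳ (1ℚ - μ n 𝒜))))
  old : ∀ i → μ (suc n) (λ z → outside 𝒜 z ∧ lookup z (suc i)) ≡ μ n (λ x → not (𝒜 x) ∧ lookup x i)
  old i = trans (𝔼-split n _) (solve 1 (λ r → con ½ :* (r :+ r) := r) refl _)

star-on-lift : Star → ∀ n (𝒜 ℬ : Family n) → Increasing 𝒜 → Increasing ℬ →
  ½ * (μ n ℬ - μ n (𝒜 ∩ ℬ)) ≤ lam (suc n) (lift (𝟙 ℬ)) zero * (½ * (1ℚ - μ n 𝒜))
                              + ΣFin n (λ i → lam n (𝟙 ℬ) i * μ n (λ x → not (𝒜 x) ∧ lookup x i))
star-on-lift star n 𝒜 ℬ inc𝒜 incℬ = subst₂ _≤_ (star-left n 𝒜 ℬ) (star-right n 𝒜 ℬ)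
  (𝔼-mono (suc n) _ _ (star (suc n) (ℕ.s≤s ℕ.z≤n) (lift (𝟙 ℬ))
    (lift-nondecreasing (𝟙 ℬ) (indicator-nondecreasing incℬ) (λ x → ind-nonneg (ℬ x)))
    (lift-antipodal (𝟙 ℬ)) (outside 𝒜) (outside-decreasing inc𝒜)))

ΣFin-linear : ∀ k (a b : ℚ) (f g : Fin k → ℚ) → ΣFin k (λ i → a * f i + b * g i) ≡ a * ΣFin k f + b * ΣFin k g
ΣFin-linear k a b f g = trans (sum-+ (L.allFin k) (λ i → a * f i) (λ i → b * g i))
  (cong₂ _+_ (sum-scale (L.allFin k) a f) (sum-scale (L.allFin k) b g))

influence-sum : ∀ n (𝒜 : Family n) → Increasing 𝒜 → (w : Fin n → ℚ) →
  ΣFin n (λ i → w i * μ n (λ x → not (𝒜 x) ∧ lookup x i))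
    ≡ ½ * (1ℚ - μ n 𝒜) * ΣFin n w + (- (½ * ½)) * ΣFin n (λ i → Infl n 𝒜 i * w i)
influence-sum n 𝒜 inc w = trans (ΣFin-cong n term) (ΣFin-linear n (½ * (1ℚ - μ n 𝒜)) (- (½ * ½)) w (λ i → Infl n 𝒜 i * w i))
  where
  term : ∀ i → w i * μ n (λ x → not (𝒜 x) ∧ lookup x i)
             ≡ ½ * (1ℚ - μ n 𝒜) * w i + (- (½ * ½)) * (Infl n 𝒜 i * w i)
  term i = trans (cong (w i *_) (outside-coordinate n 𝒜 inc i))
    (solve 3 (λ w a I → w :* (con ½ :* (con 1ℚ :- a) :- con ½ :* con ½ :* I)
                      := con ½ :* (con 1ℚ :- a) :* w :+ (:- (con ½ :* con ½)) :* (I :* w)) refl (w i) (μ n 𝒜) (Infl n 𝒜 i))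

-- With λ₀ + S₁ = μℬ and R = ½(1 − μ𝒜)S₁ − ¼S₂, the normalised inequality
-- ½(μℬ − μ(𝒜∩ℬ)) ≤ ½λ₀(1 − μ𝒜) + R is twice  ½S₂ ≤ μ(𝒜∩ℬ) − μ𝒜 μℬ.
correlation-algebra : ∀ {μA μB μAB λ₀ S₁ S₂ R : ℚ} →
  ½ * (μB - μAB) ≤ λ₀ * (½ * (1ℚ - μA)) + R →
  R ≡ ½ * (1ℚ - μA) * S₁ + (- (½ * ½)) * S₂ → λ₀ + S₁ ≡ μB →
  ½ * S₂ ≤ μAB - μA * μB
correlation-algebra {μA} {_} {μAB} {λ₀} {S₁} {S₂} H refl refl =
  subst₂ _≤_ left right (+-monoˡ-≤ d (*-monoˡ-≤-nonNeg (1ℚ + 1ℚ) H))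
  where
  d = ½ * S₂ - (1ℚ + 1ℚ) * (½ * (λ₀ + S₁ - μAB))
  left : (1ℚ + 1ℚ) * (½ * (λ₀ + S₁ - μAB)) + d ≡ ½ * S₂
  left = solve 4 (λ l s t m → (con 1ℚ :+ con 1ℚ) :* (con ½ :* (l :+ s :- m))
                               :+ (con ½ :* t :- (con 1ℚ :+ con 1ℚ) :* (con ½ :* (l :+ s :- m)))
                             := con ½ :* t) refl λ₀ S₁ S₂ μAB
  right : (1ℚ + 1ℚ) * (λ₀ * (½ * (1ℚ - μA)) + (½ * (1ℚ - μA) * S₁ + (- (½ * ½)) * S₂)) + d ≡ μAB - μA * (λ₀ + S₁)
  right = solve 5 (λ l s t m a → (con 1ℚ :+ con 1ℚ) :* (l :* (con ½ :* (con 1ℚ :- a))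
                                     :+ (con ½ :* (con 1ℚ :- a) :* s :+ (:- (con ½ :* con ½)) :* t))
                                 :+ (con ½ :* t :- (con 1ℚ :+ con 1ℚ) :* (con ½ :* (l :+ s :- m)))
                               := m :- a :* (l :+ s)) refl λ₀ S₁ S₂ μAB μA

proposition5p3 : Star → (n : ℕ) → 1 ℕ.≤ n → (𝒜 ℬ : Family n) → Increasing 𝒜 → Increasing ℬ →
    ½ * ΣFin n (λ i → Infl n 𝒜 i * lam n (𝟙 ℬ) i) ≤ Cor n 𝒜 ℬ
proposition5p3 star n _ 𝒜 ℬ inc𝒜 incℬ =
  correlation-algebra {μA = μ n 𝒜} {λ₀ = λ₀} {S₂ = S₂}
    (star-on-lift star n 𝒜 ℬ inc𝒜 incℬ) (influence-sum n 𝒜 inc𝒜 (lam n (𝟙 ℬ))) mass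
  where
  λ₀ S₂ : ℚ
  λ₀ = lam (suc n) (lift (𝟙 ℬ)) zero
  S₂ = ΣFin n (λ i → Infl n 𝒜 i * lam n (𝟙 ℬ) i)
  ind-sq : ∀ b → sq (ind b) ≡ ind b
  ind-sq true  = refl
  ind-sq false = refl
  mass : λ₀ + ΣFin n (lam n (𝟙 ℬ)) ≡ μ n ℬ
  mass = trans (lift-spectrum n (𝟙 ℬ)) (𝔼-cong n (λ x → ind-sq (ℬ x)))
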